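{- For every integer $n \ge 4$, with $P_{n,H}(k) := P(|S-S| = k)$ where $S$ is a uniformly random subset of $[n]=\{0,\dots,n-1\}$, we have $P_{n,H}(3) > P_{n,H}(5) < P_{n,H}(7)$.
   Context: For a positive integer $n$, $[n] := \{0,1,\dots,n-1\}$, and $S$ is chosen uniformly at random among all $2^n$ subsets of $[n]$. The difference set is $S-S := \{x-y : x,y \in S\}$. -}

module Defs where

open import Data.Nat using (ℕ; zero; suc; _^_; _≟_)
open import Data.Nat.Properties using (m^n≢0)
open import Data.Integer using (ℤ; +_; _-_) renaming (_≟_ to _≟ℤ_)
open import Data.Fin using (Fin; toℕ)
open import Data.Fin.Subset using (Subset; _∈_; ⊤)
open import Data.Fin.Subset.Properties using (_∈?_)
open import Data.List using (List; []; _∷_; map; filter; length; allFin; concatMap; deduplicate; cartesianProductWith)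
open import Data.Vec using (Vec; _∷_; [])
open import Data.Rational using (ℚ; _/_)

allSubsets : (n : ℕ) → List (Subset n)
allSubsets zero = [] ∷ []
allSubsets (suc n) = concatMap (λ S → (Data.Fin.Subset.inside ∷ S) ∷ (Data.Fin.Subset.outside ∷ S) ∷ []) (allSubsets n)

elements : {n : ℕ} → Subset n → List ℕ
elements {n} S = map toℕ (filter (_∈? S) (allFin n))

diffSet : {n : ℕ} → Subset n → List ℤ
diffSet S = deduplicate _≟ℤ_ (cartesianProductWith (λ x y → + x - + y) (elements S) (elements S))

diffSize : {n : ℕ} → Subset n → ℕ
diffSize S = length (diffSet S)

countH : ℕ → ℕ → ℕ
countH n k = length (filter (λ S → diffSize S ≟ k) (allSubsets n))

P : ℕ → ℕ → ℚ
P n k = _/_ (+ countH n k) (2 ^ n) {{m^n≢0 2 n}}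

module Submission where

-- A set S ⊆ [n] has |S − S| = 5 exactly when it is a progression {a, a + d, a + 2d} with d ≥ 1:
-- two-element sets have 3 differences, other three-element sets have 7, and four elements
-- already give at least 7. Dropping the largest element maps these progressions injectively to
-- two-element sets and never reaches {0, n − 1}. Moving the middle element down by one maps them
-- injectively to three-element non-progressions, never reaching {0, 1, 2, 3}, which also has
-- 7 differences; for d = 1 this is replaced by {0, 1, 2} ↦ {0, 1, 3} and, for a ≥ 1,
-- {a, a + 1, a + 2} ↦ {a − 1, a + 1, a + 2}.

open import Defs
open import Data.Bool using (true; false)
open import Data.Empty using (⊥-elim)
open import Data.Fin using (Fin; zero; suc; toℕ)
import Data.Fin.Properties as Fin
open import Data.Fin.Subset as Subset using (Subset; inside; outside)
import Data.Fin.Subset.Properties as Subset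
open import Data.Integer as ℤ using (ℤ; +_; +<+)
import Data.Integer.Properties as ℤ
import Data.Integer.Tactic.RingSolver as ℤ-Solver
open import Data.List using (List; []; _∷_; length; lookup; map; filter; allFin; deduplicate; cartesianProductWith)
open import Data.List.Properties using (length-map; ∷-injective; ∷-injectiveˡ)
open import Data.List.Membership.Propositional using (_∈_)
open import Data.List.Membership.Propositional.Properties
  using (∈-lookup; ∈-filter⁺; ∈-filter⁻; ∈-map⁺; ∈-map⁻; ∈-map∘filter⁻; ∈-allFin; ∈-concatMap⁺;
         ∈-deduplicate⁺; ∈-deduplicate⁻; ∈-cartesianProductWith⁺; ∈-cartesianProductWith⁻)
import Data.List.Membership.DecPropositional as DecMembership
open import Data.List.Membership.Setoid.Properties using (index-injective)
open import Data.List.Relation.Binary.Disjoint.Propositional using (Disjoint)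
open import Data.List.Relation.Binary.Subset.Propositional using (_⊆_)
open import Data.List.Relation.Unary.All as All using (All; []; _∷_)
import Data.List.Relation.Unary.All.Properties as All
open import Data.List.Relation.Unary.AllPairs as AllPairs using (AllPairs; []; _∷_)
import Data.List.Relation.Unary.AllPairs.Properties as AllPairs
open import Data.List.Relation.Unary.Any as Any using (here; there; index)
open import Data.List.Relation.Unary.Linked as Linked using (Linked; []; [-]; _∷_)
import Data.List.Relation.Unary.Linked.Properties as Linked
open import Data.List.Relation.Unary.Linked.Properties using (AllPairs⇒Linked; Linked⇒AllPairs)
open import Data.List.Relation.Unary.Unique.Propositional using (Unique)
import Data.List.Relation.Unary.Unique.Propositional.Properties as Unique
import Data.List.Relation.Unary.Unique.DecPropositional.Properties as DecUnique
open import Data.Nat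
  using (ℕ; zero; suc; _+_; _∸_; _^_; _≤_; _<_; _≥_; _≟_; _≤?_; z≤n; s≤s; s≤s⁻¹; z<s; s<s; NonZero)
open import Data.Nat.Properties
import Data.Nat.Tactic.RingSolver as ℕ-Solver
open import Data.Product using (_×_; _,_; proj₁; proj₂; uncurry; ∃-syntax; ∃₂)
open import Data.Rational as ℚ using (_/_)
import Data.Rational.Properties as ℚ
import Data.Rational.Unnormalised as ℚᵘ
import Data.Rational.Unnormalised.Properties as ℚᵘ
open import Data.Vec using (_∷_; []; tail; tabulate)
open import Data.Vec.Properties using (lookup∘tabulate; lookup⇒[]=; []=⇒lookup)
open import Function using (id; _∘_; _on_)
open import Relation.Binary.Core using (_⇒_)
open import Relation.Binary.Definitions using (tri<; tri≈; tri>)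
open import Relation.Binary.PropositionalEquality
  using (_≡_; _≢_; refl; sym; trans; cong; cong₂; subst; setoid; module ≡-Reasoning)
open import Relation.Nullary using (does; yes; no; contradiction)
open import Relation.Nullary.Decidable using (dec-true; from-no)
open import Relation.Unary using (Pred; Decidable)

open DecMembership _≟_ using (_∈?_)

module _ {a} {A : Set a} where

  Unique⇒lookup-injective : ∀ {xs : List A} → Unique xs →
                            ∀ {i j} → lookup xs i ≡ lookup xs j → i ≡ j
  Unique⇒lookup-injective {_ ∷ _} _ {zero} {zero} _ = refl
  Unique⇒lookup-injective (x∉xs ∷ _) {zero} {suc j} eq = ⊥-elim (All.lookup x∉xs (∈-lookup j) eq)
  Unique⇒lookup-injective (x∉xs ∷ _) {suc i} {zero} eq = ⊥-elim (All.lookup x∉xs (∈-lookup i) (sym eq))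
  Unique⇒lookup-injective (_ ∷ unique) {suc i} {suc j} eq = cong suc (Unique⇒lookup-injective unique eq)

  Unique⇒length≤ : ∀ {xs ys : List A} → Unique xs → xs ⊆ ys → length xs ≤ length ys
  Unique⇒length≤ {xs} {ys} unique xs⊆ys = Fin.injective⇒≤ position-injective
    where
    position : Fin (length xs) → Fin (length ys)
    position i = index (xs⊆ys (∈-lookup i))

    position-injective : ∀ {i j} → position i ≡ position j → i ≡ j
    position-injective eq =
      Unique⇒lookup-injective unique (index-injective (setoid A) (xs⊆ys (∈-lookup _)) (xs⊆ys (∈-lookup _)) eq)

  filter-length-< : ∀ {p q} {P : Pred A p} {Q : Pred A q} (P? : Decidable P) (Q? : Decidable Q) →
                    ∀ {xs} → Unique xs → (∀ x → x ∈ xs) →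
                    (f : ∀ {x} → P x → A) → (∀ {x} (px : P x) → Q (f px)) →
                    (∀ {x y} (px : P x) (py : P y) → f px ≡ f py → x ≡ y) →
                    (s : A) → Q s → (∀ {x} (px : P x) → f px ≢ s) →
                    length (filter P? xs) < length (filter Q? xs)
  filter-length-< {P = P} {Q} P? Q? {xs} unique complete f f-Q f-injective s s-Q f≢s =
    Fin.injective⇒≤ position-injective
    where
    Ps = filter P? xs

    P-lookup : ∀ i → P (lookup Ps i)
    P-lookup i = proj₂ (∈-filter⁻ P? {xs = xs} (∈-lookup i))

    positionInQ : ∀ {y} → Q y → Fin (length (filter Q? xs))
    positionInQ {y} qy = index (∈-filter⁺ Q? (complete y) qy)

    position : Fin (suc (length Ps)) → Fin (length (filter Q? xs))
    position zero    = positionInQ s-Q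
    position (suc i) = positionInQ (f-Q (P-lookup i))

    positionInQ-injective : ∀ {y z} (qy : Q y) (qz : Q z) → positionInQ qy ≡ positionInQ qz → y ≡ z
    positionInQ-injective qy qz =
      index-injective (setoid A) (∈-filter⁺ Q? (complete _) qy) (∈-filter⁺ Q? (complete _) qz)

    position-injective : ∀ {i j} → position i ≡ position j → i ≡ j
    position-injective {zero} {zero} _ = refl
    position-injective {zero} {suc j} eq = ⊥-elim (f≢s (P-lookup j) (sym (positionInQ-injective _ _ eq)))
    position-injective {suc i} {zero} eq = ⊥-elim (f≢s (P-lookup i) (positionInQ-injective _ _ eq))
    position-injective {suc i} {suc j} eq = cong suc (Unique⇒lookup-injective (Unique.filter⁺ P? unique)
      (f-injective (P-lookup i) (P-lookup j) (positionInQ-injective _ _ eq)))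

extensions : ∀ {n} → Subset n → List (Subset (suc n))
extensions S = (inside ∷ S) ∷ (outside ∷ S) ∷ []

tail-∈-extensions : ∀ {n} {S : Subset n} {T} → T ∈ extensions S → tail T ≡ S
tail-∈-extensions (here refl)         = refl
tail-∈-extensions (there (here refl)) = refl

allSubsets-complete : ∀ {n} (S : Subset n) → S ∈ allSubsets n
allSubsets-complete []      = here refl
allSubsets-complete (b ∷ S) = ∈-concatMap⁺ extensions (Any.map (λ { refl → extension b }) (allSubsets-complete S))
  where
  extension : ∀ b → (b ∷ S) ∈ extensions S
  extension true  = here refl
  extension false = there (here refl)

allSubsets-unique : ∀ n → Unique (allSubsets n)
allSubsets-unique zero    = [] ∷ []
allSubsets-unique (suc n) =
  Unique.concat⁺ (All.map⁺ (All.universal (λ _ → ((λ ()) ∷ []) ∷ [] ∷ []) (allSubsets n)))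
                 (AllPairs.map⁺ (AllPairs.map extensions-disjoint (allSubsets-unique n)))
  where
  extensions-disjoint : ∀ {S T : Subset n} → S ≢ T → Disjoint (extensions S) (extensions T)
  extensions-disjoint S≢T (U∈S , U∈T) = S≢T (trans (sym (tail-∈-extensions U∈S)) (tail-∈-extensions U∈T))

IncreasingBelow : ℕ → List ℕ → Set
IncreasingBelow n xs = Linked _<_ xs × All (_< n) xs

module _ {n : ℕ} where

  ∈-elements⁺ : ∀ {S : Subset n} {i} → i Subset.∈ S → toℕ i ∈ elements S
  ∈-elements⁺ {S} {i} i∈S = ∈-map⁺ toℕ (∈-filter⁺ (Subset._∈? S) (∈-allFin i) i∈S)

  ∈-elements⁻ : ∀ {S : Subset n} {m} → m ∈ elements S → ∃[ i ] m ≡ toℕ i × i Subset.∈ S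
  ∈-elements⁻ {S} m∈S with i , _ , m≡i , i∈S ← ∈-map∘filter⁻ toℕ (Subset._∈? S) {xs = allFin n} m∈S =
    i , m≡i , i∈S

  elements-strictlySorted : (S : Subset n) → AllPairs _<_ (elements S)
  elements-strictlySorted S = AllPairs.map⁺ (AllPairs.filter⁺ (Subset._∈? S) (AllPairs.tabulate⁺-< id))

  elements-increasingBelow : (S : Subset n) → IncreasingBelow n (elements S)
  elements-increasingBelow S = AllPairs⇒Linked (elements-strictlySorted S) , All.tabulate bounded
    where
    bounded : ∀ {m} → m ∈ elements S → m < n
    bounded m∈S with i , refl , _ ← ∈-elements⁻ m∈S = Fin.toℕ<n i

  elements-⊆ : ∀ {S T : Subset n} → elements S ≡ elements T → S Subset.⊆ T
  elements-⊆ eq i∈S with j , i≡j , j∈T ← ∈-elements⁻ (subst (_ ∈_) eq (∈-elements⁺ i∈S))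
    rewrite Fin.toℕ-injective i≡j = j∈T

  elements-injective : ∀ {S T : Subset n} → elements S ≡ elements T → S ≡ T
  elements-injective eq = Subset.⊆-antisym (elements-⊆ eq) (elements-⊆ (sym eq))

  fromElements : List ℕ → Subset n
  fromElements xs = tabulate (λ i → does (toℕ i ∈? xs))

  ∈-fromElements⁺ : ∀ {xs} {i : Fin n} → toℕ i ∈ xs → i Subset.∈ fromElements xs
  ∈-fromElements⁺ {xs} {i} i∈xs = lookup⇒[]= i _ (trans (lookup∘tabulate _ i) (dec-true (toℕ i ∈? xs) i∈xs))

  ∈-fromElements⁻ : ∀ {xs} {i : Fin n} → i Subset.∈ fromElements xs → toℕ i ∈ xs
  ∈-fromElements⁻ {xs} {i} i∈S with toℕ i ∈? xs | trans (sym (lookup∘tabulate _ i)) ([]=⇒lookup i∈S)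
  ... | yes i∈xs | _ = i∈xs
  ... | no _     | ()

∈-∷⇒head-≤ : ∀ {x y xs} → All (x <_) xs → y ∈ x ∷ xs → x ≤ y
∈-∷⇒head-≤ _    (here refl)  = ≤-refl
∈-∷⇒head-≤ x<xs (there y∈xs) = <⇒≤ (All.lookup x<xs y∈xs)

AllPairs-<-⊆-antisym : ∀ {xs ys} → AllPairs _<_ xs → AllPairs _<_ ys → xs ⊆ ys → ys ⊆ xs → xs ≡ ys
AllPairs-<-⊆-antisym {[]}    {[]}    _ _ _ _ = refl
AllPairs-<-⊆-antisym {[]}    {_ ∷ _} _ _ _ ys⊆xs with () ← ys⊆xs (here refl)
AllPairs-<-⊆-antisym {_ ∷ _} {[]}    _ _ xs⊆ys _ with () ← xs⊆ys (here refl)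
AllPairs-<-⊆-antisym {x ∷ xs} {y ∷ ys} (x<xs ∷ xs<) (y<ys ∷ ys<) xs⊆ys ys⊆xs
  with refl ← ≤-antisym (∈-∷⇒head-≤ y<ys (xs⊆ys (here refl))) (∈-∷⇒head-≤ x<xs (ys⊆xs (here refl)))
  = cong (x ∷_) (AllPairs-<-⊆-antisym xs< ys<
      (λ z∈xs → Any.tail (>⇒≢ (All.lookup x<xs z∈xs)) (xs⊆ys (there z∈xs)))
      (λ z∈ys → Any.tail (>⇒≢ (All.lookup y<ys z∈ys)) (ys⊆xs (there z∈ys))))

elements-fromElements : ∀ {n xs} → IncreasingBelow n xs → elements (fromElements {n} xs) ≡ xs
elements-fromElements {n} {xs} (xs-increasing , xs<n) =
  AllPairs-<-⊆-antisym (elements-strictlySorted _) (Linked⇒AllPairs <-trans xs-increasing) ⊆xs xs⊆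
  where
  ⊆xs : elements (fromElements xs) ⊆ xs
  ⊆xs m∈S with i , m≡i , i∈S ← ∈-elements⁻ m∈S = subst (_∈ xs) (sym m≡i) (∈-fromElements⁻ i∈S)

  xs⊆ : xs ⊆ elements (fromElements xs)
  xs⊆ m∈xs with m<n ← All.lookup xs<n m∈xs rewrite sym (Fin.toℕ-fromℕ< m<n) =
    ∈-elements⁺ (∈-fromElements⁺ m∈xs)

increasingBelow₃ : ∀ {x y z n} → x < y → y < z → z < n → IncreasingBelow n (x ∷ y ∷ z ∷ [])
increasingBelow₃ x<y y<z z<n = (x<y ∷ y<z ∷ [-]) , (<-trans x<y y<n ∷ y<n ∷ z<n ∷ [])
  where y<n = <-trans y<z z<n

pattern ∈₀ = here refl
pattern ∈₁ = there ∈₀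
pattern ∈₂ = there ∈₁
pattern ∈₃ = there ∈₂
pattern ∈₄ = there ∈₃
pattern ∈₅ = there ∈₄
pattern ∈₆ = there ∈₅

diff : ℕ → ℕ → ℤ
diff x y = + x ℤ.- + y

differences : List ℕ → List ℤ
differences xs = deduplicate ℤ._≟_ (cartesianProductWith diff xs xs)

diff-diag : ∀ x y → diff x x ≡ diff y y
diff-diag x y = trans (ℤ.+-inverseʳ (+ x)) (sym (ℤ.+-inverseʳ (+ y)))

∈-differences⁺ : ∀ {x y xs} → x ∈ xs → y ∈ xs → diff x y ∈ differences xs
∈-differences⁺ x∈xs y∈xs = ∈-deduplicate⁺ ℤ._≟_ (∈-cartesianProductWith⁺ diff x∈xs y∈xs)

length-differences≤ : ∀ {xs} zs → (∀ {x y} → x ∈ xs → y ∈ xs → diff x y ∈ zs) →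
                      length (differences xs) ≤ length zs
length-differences≤ {xs} zs diffs∈zs = Unique⇒length≤ (DecUnique.deduplicate-! ℤ._≟_ _) differences⊆zs
  where
  differences⊆zs : ∀ {z} → z ∈ differences xs → z ∈ zs
  differences⊆zs z∈
    with x , y , x∈xs , y∈xs , refl ← ∈-cartesianProductWith⁻ diff xs xs (∈-deduplicate⁻ ℤ._≟_ _ z∈)
    = diffs∈zs x∈xs y∈xs

-- (x , y) ≺ (z , w) says x − y < z − w, with both sides moved so that no subtraction occurs.
_≺_ : ℕ × ℕ → ℕ × ℕ → Set
(x , y) ≺ (z , w) = x + w < z + y

≺⇒diff-< : _≺_ ⇒ (ℤ._<_ on uncurry diff)
≺⇒diff-< {x , y} {z , w} x+w<z+y = begin-strict
  + x ℤ.- + y                         ≡⟨ add-both (+ x) (+ y) (+ w) ⟩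
  (+ x ℤ.+ + w) ℤ.- (+ y ℤ.+ + w)     ≡⟨ cong (ℤ._- (+ y ℤ.+ + w)) (ℤ.pos-+ x w) ⟨
  + (x + w) ℤ.- (+ y ℤ.+ + w)         <⟨ ℤ.+-monoˡ-< (ℤ.- (+ y ℤ.+ + w)) (+<+ x+w<z+y) ⟩
  + (z + y) ℤ.- (+ y ℤ.+ + w)         ≡⟨ cong (ℤ._- (+ y ℤ.+ + w)) (ℤ.pos-+ z y) ⟩
  (+ z ℤ.+ + y) ℤ.- (+ y ℤ.+ + w)     ≡⟨ cancel-middle (+ z) (+ y) (+ w) ⟩
  + z ℤ.- + w                         ∎
  where
  open ℤ.≤-Reasoning

  add-both : ∀ i j k → i ℤ.- j ≡ (i ℤ.+ k) ℤ.- (j ℤ.+ k)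
  add-both = ℤ-Solver.solve-∀

  cancel-middle : ∀ i j k → (i ℤ.+ j) ℤ.- (j ℤ.+ k) ≡ i ℤ.- k
  cancel-middle = ℤ-Solver.solve-∀

length-differences≥ : ∀ xs (ps : List (ℕ × ℕ)) → All (λ (x , y) → x ∈ xs × y ∈ xs) ps →
                      Linked _≺_ ps → length ps ≤ length (differences xs)
length-differences≥ xs ps ps∈xs increasing = subst (_≤ length (differences xs)) (length-map (uncurry diff) ps)
  (Unique⇒length≤ (AllPairs.map ℤ.<⇒≢ (Linked⇒AllPairs ℤ.<-trans differences-increasing)) covered)
  where
  differences-increasing : Linked ℤ._<_ (map (uncurry diff) ps)
  differences-increasing = Linked.map⁺ {f = uncurry diff} (Linked.map (λ {p} {q} → ≺⇒diff-< {p} {q}) increasing)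

  covered : ∀ {z} → z ∈ map (uncurry diff) ps → z ∈ differences xs
  covered z∈ with _ , p∈ps , refl ← ∈-map⁻ (uncurry diff) z∈ = uncurry ∈-differences⁺ (All.lookup ps∈xs p∈ps)

length-differences-pair : ∀ {a b} → a < b → length (differences (a ∷ b ∷ [])) ≡ 3
length-differences-pair {a} {b} a<b = ≤-antisym
  (length-differences≤ ds covered)
  (length-differences≥ (a ∷ b ∷ []) ((a , b) ∷ (a , a) ∷ (b , a) ∷ [])
    ((∈₀ , ∈₁) ∷ (∈₀ , ∈₀) ∷ (∈₁ , ∈₀) ∷ [])
    (+-monoʳ-< a a<b ∷ +-monoˡ-< a a<b ∷ [-]))
  where
  ds = diff a b ∷ diff a a ∷ diff b a ∷ []

  covered : ∀ {x y} → x ∈ a ∷ b ∷ [] → y ∈ a ∷ b ∷ [] → diff x y ∈ ds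
  covered ∈₀ ∈₀ = ∈₁
  covered ∈₀ ∈₁ = ∈₀
  covered ∈₁ ∈₀ = ∈₂
  covered ∈₁ ∈₁ = subst (_∈ ds) (diff-diag a b) ∈₁

length-differences-triple : ∀ {a b c} → a < b → b < c → b + b ≢ a + c →
                            length (differences (a ∷ b ∷ c ∷ [])) ≡ 7
length-differences-triple {a} {b} {c} a<b b<c unbalanced = ≤-antisym (length-differences≤ ds covered) seven≤
  where
  ds = diff a b ∷ diff a c ∷ diff b c ∷ diff a a ∷ diff b a ∷ diff c a ∷ diff c b ∷ []

  covered : ∀ {x y} → x ∈ a ∷ b ∷ c ∷ [] → y ∈ a ∷ b ∷ c ∷ [] → diff x y ∈ ds
  covered ∈₀ ∈₀ = ∈₃
  covered ∈₀ ∈₁ = ∈₀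
  covered ∈₀ ∈₂ = ∈₁
  covered ∈₁ ∈₀ = ∈₄
  covered ∈₁ ∈₁ = subst (_∈ ds) (diff-diag a b) ∈₃
  covered ∈₁ ∈₂ = ∈₂
  covered ∈₂ ∈₀ = ∈₅
  covered ∈₂ ∈₁ = ∈₆
  covered ∈₂ ∈₂ = subst (_∈ ds) (diff-diag a c) ∈₃

  -- whether b − a < c − b depends on the sign of (b + b) − (a + c)
  seven≤ : 7 ≤ length (differences (a ∷ b ∷ c ∷ []))
  seven≤ with <-cmp (b + b) (a + c)
  ... | tri< b+b<a+c _ _ = length-differences≥ (a ∷ b ∷ c ∷ [])
          ((a , c) ∷ (b , c) ∷ (a , b) ∷ (a , a) ∷ (b , a) ∷ (c , b) ∷ (c , a) ∷ [])
          ((∈₀ , ∈₂) ∷ (∈₁ , ∈₂) ∷ (∈₀ , ∈₁) ∷ (∈₀ , ∈₀) ∷ (∈₁ , ∈₀) ∷ (∈₂ , ∈₁) ∷ (∈₂ , ∈₀) ∷ [])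
          (+-monoˡ-< c a<b ∷ b+b<a+c ∷ +-monoʳ-< a a<b ∷ +-monoˡ-< a a<b ∷
           subst (b + b <_) (+-comm a c) b+b<a+c ∷ +-monoʳ-< c a<b ∷ [-])
  ... | tri≈ _ b+b≡a+c _ = ⊥-elim (unbalanced b+b≡a+c)
  ... | tri> _ _ a+c<b+b = length-differences≥ (a ∷ b ∷ c ∷ [])
          ((a , c) ∷ (a , b) ∷ (b , c) ∷ (a , a) ∷ (c , b) ∷ (b , a) ∷ (c , a) ∷ [])
          ((∈₀ , ∈₂) ∷ (∈₀ , ∈₁) ∷ (∈₁ , ∈₂) ∷ (∈₀ , ∈₀) ∷ (∈₂ , ∈₁) ∷ (∈₁ , ∈₀) ∷ (∈₂ , ∈₀) ∷ [])
          (+-monoʳ-< a b<c ∷ a+c<b+b ∷ subst (_< a + c) (+-comm a b) (+-monoʳ-< a b<c) ∷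
           subst (a + b <_) (+-comm a c) (+-monoʳ-< a b<c) ∷
           subst (_< b + b) (+-comm a c) a+c<b+b ∷ +-monoˡ-< a b<c ∷ [-])

length-differences-≥4 : ∀ {a b c d xs} → Linked _<_ (a ∷ b ∷ c ∷ d ∷ xs) →
                        7 ≤ length (differences (a ∷ b ∷ c ∷ d ∷ xs))
length-differences-≥4 {a} {b} {c} {d} {xs} (a<b ∷ b<c ∷ c<d ∷ _) = length-differences≥ (a ∷ b ∷ c ∷ d ∷ xs)
  ((a , d) ∷ (a , c) ∷ (a , b) ∷ (a , a) ∷ (b , a) ∷ (c , a) ∷ (d , a) ∷ [])
  ((∈₀ , ∈₃) ∷ (∈₀ , ∈₂) ∷ (∈₀ , ∈₁) ∷ (∈₀ , ∈₀) ∷ (∈₁ , ∈₀) ∷ (∈₂ , ∈₀) ∷ (∈₃ , ∈₀) ∷ [])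
  (+-monoʳ-< a c<d ∷ +-monoʳ-< a b<c ∷ +-monoʳ-< a a<b ∷
   +-monoˡ-< a a<b ∷ +-monoˡ-< a b<c ∷ +-monoˡ-< a c<d ∷ [-])

progression : ℕ → ℕ → List ℕ
progression a d = a ∷ a + d ∷ a + (d + d) ∷ []

+-double : ∀ a d → (a + d) + (a + d) ≡ a + (a + (d + d))
+-double = ℕ-Solver.solve-∀

progression-intro : ∀ {a b c} → a < b → b + b ≡ a + c → ∃[ k ] a ∷ b ∷ c ∷ [] ≡ progression a (suc k)
progression-intro {a} {b} {c} a<b balanced = k , cong (a ∷_) (cong₂ _∷_ b≡a+d (cong (_∷ []) c≡a+2d))
  where
  open ≡-Reasoning

  k = b ∸ suc a

  b≡a+d : b ≡ a + suc k
  b≡a+d = sym (trans (+-suc a k) (m+[n∸m]≡n a<b))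

  c≡a+2d : c ≡ a + (suc k + suc k)
  c≡a+2d = +-cancelˡ-≡ a _ _ (begin
    a + c                      ≡⟨ balanced ⟨
    b + b                      ≡⟨ cong₂ _+_ b≡a+d b≡a+d ⟩
    (a + suc k) + (a + suc k)  ≡⟨ +-double a (suc k) ⟩
    a + (a + (suc k + suc k))  ∎)

length-differences≡5⇒progression : ∀ {xs} → Linked _<_ xs → length (differences xs) ≡ 5 →
                                   ∃₂ λ a k → xs ≡ progression a (suc k)
length-differences≡5⇒progression [] ()
length-differences≡5⇒progression [-] ()
length-differences≡5⇒progression (a<b ∷ [-]) five =
  contradiction (trans (sym (length-differences-pair a<b)) five) λ ()
length-differences≡5⇒progression {a ∷ b ∷ c ∷ []} (a<b ∷ b<c ∷ [-]) five with b + b ≟ a + c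
... | yes balanced  = a , progression-intro a<b balanced
... | no unbalanced = contradiction (trans (sym (length-differences-triple a<b b<c unbalanced)) five) λ ()
length-differences≡5⇒progression increasing@(_ ∷ _ ∷ _ ∷ _) five =
  contradiction (subst (7 ≤_) five (length-differences-≥4 increasing)) (from-no (7 ≤? 5))

balanced⇒double-gap : ∀ a g h → (a + g) + (a + g) ≡ a + (a + h) → g + g ≡ h
balanced⇒double-gap a g h balanced = +-cancelˡ-≡ a _ _ (+-cancelˡ-≡ a _ _ (trans (sym (+-double a g)) balanced))

ThreeTermProgression : ∀ {n} → Subset n → Set
ThreeTermProgression S = ∃₂ λ a k → elements S ≡ progression a (suc k)

diffSize≡5⇒progression : ∀ {n} (S : Subset n) → diffSize S ≡ 5 → ThreeTermProgression S
diffSize≡5⇒progression S = length-differences≡5⇒progression (proj₁ (elements-increasingBelow S))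

encoding⇒countH-5< : ∀ {n t} (encode : ℕ → ℕ → List ℕ) →
  (∀ {a k} → IncreasingBelow n (progression a (suc k)) → IncreasingBelow n (encode a k)) →
  (∀ a k → length (differences (encode a k)) ≡ t) →
  (∀ {a k b l} → encode a k ≡ encode b l → a ≡ b × k ≡ l) →
  (xs : List ℕ) → IncreasingBelow n xs → length (differences xs) ≡ t →
  (∀ {a k} → IncreasingBelow n (progression a (suc k)) → encode a k ≢ xs) →
  countH n 5 < countH n t
encoding⇒countH-5< {n} {t} encode encode-increasingBelow encode-size encode-injective
                   xs xs-increasingBelow xs-size xs-missed =
  filter-length-< (λ S → diffSize S ≟ 5) (λ S → diffSize S ≟ t) (allSubsets-unique n) allSubsets-complete
    (encodeSubset ∘ diffSize≡5⇒progression _) (encodeSubset-size ∘ diffSize≡5⇒progression _)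
    (λ five five′ → encodeSubset-injective (diffSize≡5⇒progression _ five) (diffSize≡5⇒progression _ five′))
    (fromElements xs) (trans (cong (length ∘ differences) (elements-fromElements xs-increasingBelow)) xs-size)
    (encodeSubset-missed ∘ diffSize≡5⇒progression _)
  where
  progression-increasingBelow : ∀ {S : Subset n} ((a , k , _) : ThreeTermProgression S) →
                                IncreasingBelow n (progression a (suc k))
  progression-increasingBelow {S} (_ , _ , S≡) = subst (IncreasingBelow n) S≡ (elements-increasingBelow S)

  encodeSubset : ∀ {S : Subset n} → ThreeTermProgression S → Subset n
  encodeSubset (a , k , _) = fromElements (encode a k)

  elements-encodeSubset : ∀ {S : Subset n} (p@(a , k , _) : ThreeTermProgression S) →
                          elements (encodeSubset p) ≡ encode a k
  elements-encodeSubset p = elements-fromElements (encode-increasingBelow (progression-increasingBelow p))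

  encodeSubset-size : ∀ {S : Subset n} (p@(a , k , _) : ThreeTermProgression S) → diffSize (encodeSubset p) ≡ t
  encodeSubset-size p@(a , k , _) = trans (cong (length ∘ differences) (elements-encodeSubset p)) (encode-size a k)

  encodeSubset-injective : ∀ {S T : Subset n} (p : ThreeTermProgression S) (q : ThreeTermProgression T) →
                           encodeSubset p ≡ encodeSubset q → S ≡ T
  encodeSubset-injective p@(_ , _ , S≡) q@(_ , _ , T≡) eq
    with refl , refl ← encode-injective
                         (trans (sym (elements-encodeSubset p)) (trans (cong elements eq) (elements-encodeSubset q)))
    = elements-injective (trans S≡ (sym T≡))

  encodeSubset-missed : ∀ {S : Subset n} (p : ThreeTermProgression S) → encodeSubset p ≢ fromElements xs
  encodeSubset-missed p eq = xs-missed (progression-increasingBelow p)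
    (trans (sym (elements-encodeSubset p)) (trans (cong elements eq) (elements-fromElements xs-increasingBelow)))

countH-5<3 : ∀ {n} → 2 ≤ n → countH n 5 < countH n 3
countH-5<3 {suc (suc m)} (s≤s (s≤s _)) =
  encoding⇒countH-5< (λ a k → a ∷ a + suc k ∷ [])
    (λ { ((a<b ∷ _) , (a<n ∷ b<n ∷ _)) → (a<b ∷ [-]) , (a<n ∷ b<n ∷ []) })
    (λ a k → length-differences-pair (m<m+n a z<s))
    pair-injective
    (0 ∷ suc m ∷ []) ((z<s ∷ [-]) , (z<s ∷ n<1+n (suc m) ∷ [])) (length-differences-pair (z<s {m}))
    missed
  where
  pair-injective : ∀ {a k b l} → a ∷ a + suc k ∷ [] ≡ b ∷ b + suc l ∷ [] → a ≡ b × k ≡ l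
  pair-injective {a} eq with refl , tail≡ ← ∷-injective eq =
    refl , suc-injective (+-cancelˡ-≡ a _ _ (∷-injectiveˡ tail≡))

  missed : ∀ {a k} → IncreasingBelow (suc (suc m)) (progression a (suc k)) →
           a ∷ a + suc k ∷ [] ≢ 0 ∷ suc m ∷ []
  missed ((_ ∷ b<c ∷ [-]) , (_ ∷ _ ∷ c<n ∷ [])) refl = <⇒≱ b<c (s≤s⁻¹ c<n)

-- skew a k is the image of progression a (suc k).
skew : ℕ → ℕ → List ℕ
skew a       (suc k) = a ∷ a + suc k ∷ a + (suc (suc k) + suc (suc k)) ∷ []
skew (suc a) zero    = a ∷ a + 2 ∷ a + 3 ∷ []
skew zero    zero    = 0 ∷ 1 ∷ 3 ∷ []

triple-injective : ∀ {a g h b g′ h′} → a ∷ a + g ∷ a + h ∷ [] ≡ b ∷ b + g′ ∷ b + h′ ∷ [] →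
                   a ≡ b × g ≡ g′ × h ≡ h′
triple-injective {a} eq with refl , eq′ ← ∷-injective eq with eq₁ , eq₂ ← ∷-injective eq′ =
  refl , +-cancelˡ-≡ a _ _ eq₁ , +-cancelˡ-≡ a _ _ (∷-injectiveˡ eq₂)

skew-injective : ∀ {a k b l} → skew a k ≡ skew b l → a ≡ b × k ≡ l
skew-injective {_}     {suc _} {_}     {suc _} eq with refl , refl , _ ← triple-injective eq = refl , refl
skew-injective {_}     {suc _} {suc _} {zero}  eq with refl , refl , () ← triple-injective eq
skew-injective {_}     {suc _} {zero}  {zero}  eq with refl , refl , () ← triple-injective {g′ = 1} eq
skew-injective {suc _} {zero}  {_}     {suc _} eq with refl , refl , () ← triple-injective eq
skew-injective {suc _} {zero}  {suc _} {zero}  eq with refl , _ ← triple-injective eq = refl , refl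
skew-injective {suc _} {zero}  {zero}  {zero}  eq with refl , () , _ ← triple-injective {g′ = 1} eq
skew-injective {zero}  {zero}  {_}     {suc _} eq with refl , refl , () ← triple-injective {g = 1} eq
skew-injective {zero}  {zero}  {suc _} {zero}  eq with refl , () , _ ← triple-injective {g = 1} eq
skew-injective {zero}  {zero}  {zero}  {zero}  _ = refl , refl

skew-increasingBelow : ∀ {n a k} → 4 ≤ n → IncreasingBelow n (progression a (suc k)) → IncreasingBelow n (skew a k)
skew-increasingBelow {a = a}     {suc k} _   (_ , _ ∷ _ ∷ c<n ∷ []) =
  increasingBelow₃ (m<m+n a z<s) (+-monoʳ-< a (m≤m+n (suc (suc k)) _)) c<n
skew-increasingBelow {n} {suc a} {zero}  _   (_ , _ ∷ _ ∷ c<n ∷ []) =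
  increasingBelow₃ (m<m+n a z<s) (+-monoʳ-< a (n<1+n 2)) (subst (_< n) (sym (+-suc a 2)) c<n)
skew-increasingBelow {a = zero}  {zero}  3<n _ = increasingBelow₃ {0} {1} {3} z<s (s<s z<s) 3<n

length-differences-skew : ∀ a k → length (differences (skew a k)) ≡ 7
length-differences-skew a (suc k) =
  length-differences-triple (m<m+n a z<s) (+-monoʳ-< a (m≤m+n (suc (suc k)) _))
    (λ balanced → <⇒≢ (+-mono-< (n<1+n (suc k)) (n<1+n (suc k))) (balanced⇒double-gap a _ _ balanced))
length-differences-skew (suc a) zero =
  length-differences-triple (m<m+n a z<s) (+-monoʳ-< a (n<1+n 2))
    (λ balanced → contradiction (balanced⇒double-gap a 2 3 balanced) λ ())
length-differences-skew zero zero = refl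

skew≢0123 : ∀ a k → skew a k ≢ 0 ∷ 1 ∷ 2 ∷ 3 ∷ []
skew≢0123 _       (suc _) ()
skew≢0123 (suc _) zero    ()
skew≢0123 zero    zero    ()

countH-5<7 : ∀ {n} → 4 ≤ n → countH n 5 < countH n 7
countH-5<7 {n} 3<n =
  encoding⇒countH-5< skew (skew-increasingBelow 3<n) length-differences-skew skew-injective
    (0 ∷ 1 ∷ 2 ∷ 3 ∷ []) 0123-increasingBelow refl (λ {a} {k} _ → skew≢0123 a k)
  where
  0123-increasingBelow : IncreasingBelow n (0 ∷ 1 ∷ 2 ∷ 3 ∷ [])
  0123-increasingBelow = (z<s ∷ s<s z<s ∷ s<s (s<s z<s) ∷ [-]) ,
                         (<-trans z<s 1<n ∷ 1<n ∷ 2<n ∷ 3<n ∷ [])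
    where
    2<n = <-trans (n<1+n 2) 3<n
    1<n = <-trans (n<1+n 1) 2<n

-- + m / d reduces to fromℚᵘ (mkℚᵘ (+ m) d-1), so the comparison is made in ℚᵘ.
/-monoˡ-< : ∀ {m n} d .{{_ : NonZero d}} → m < n → + m / d ℚ.< + n / d
/-monoˡ-< {m} {n} (suc d-1) m<n = ℚ.toℚᵘ-cancel-<
  (ℚᵘ.<-respʳ-≃ (ℚᵘ.≃-sym (ℚ.toℚᵘ-fromℚᵘ (ℚᵘ.mkℚᵘ (+ n) d-1)))
    (ℚᵘ.<-respˡ-≃ (ℚᵘ.≃-sym (ℚ.toℚᵘ-fromℚᵘ (ℚᵘ.mkℚᵘ (+ m) d-1)))
      (ℚᵘ.*<* (ℤ.*-monoʳ-<-pos (+ suc d-1) (+<+ m<n)))))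

proposition2p2 : (n : ℕ) → n ≥ 4 → (P n 3 ℚ.> P n 5) × (P n 5 ℚ.< P n 7)
proposition2p2 n n≥4 =
  /-monoˡ-< (2 ^ n) {{m^n≢0 2 n}} (countH-5<3 (≤-trans (s≤s (s≤s z≤n)) n≥4)) ,
  /-monoˡ-< (2 ^ n) {{m^n≢0 2 n}} (countH-5<7 n≥4)
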